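{- Let $G$ be a digraph, $\mathbb K$ a field, and suppose there is a vertex $v$ which is the target of exactly $k\geq 2$ edges $e_1,\dots,e_k$ (respectively, the source of exactly $k\ge 2$ edges $e_1,\dots,e_k$). Let $G_v^k$ be obtained from $G$ by deleting $e_1,\dots,e_k$, and $G_v^{(h)}=G_v^k\cup e_h$ for $h=1,\dots,k$. If $\mathrm{H}^*_\mu(G_v^{(h)};\mathbb K)=0$ for all $h=1,\dots,k$ and $\mathrm{H}^*_\mu(G_v^k;\mathbb K)=0$, then $\mathrm{H}^*_\mu(G;\mathbb K)=0$.
   Context: Digraph: finite vertex set $V$, edges $E\subseteq (V\times V)\setminus\{(v,v)\}$. A multipath of $G$ is a spanning subgraph each of whose connected components is a single vertex or a simple directed path (edges $e_1,\dots,e_n$ with $s(e_{i+1})=t(e_i)$, no repeated vertex, not a cycle); $P(G)$ is the poset of multipaths ordered by inclusion. Multipath cohomology $\mathrm{H}^*_\mu(G;\mathbb K)$: the cohomology of the complex $C^*_\mu(G;\mathbb K)$ whose degree $n$ part has basis $\{b_H\}$ indexed by multipaths $H$ with $n$ edges, with differential $d b_H=\sum_{e}(-1)^{\epsilon(H,H\cup e)}b_{H\cup e}$, sum over edges $e\notin H$ such that $H\cup e$ is a multipath, where $\epsilon(H,H\cup e)$ is the number of edges of $H$ preceding $e$ in a fixed total order of $E(G)$ (the cohomology does not depend on this choice). -}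

module Defs where

open import Level using (Level; _⊔_)
open import Algebra.Bundles using (CommutativeRing)
open import Data.Bool using (Bool; true; false; if_then_else_; _∧_; _∨_; not)
open import Data.Nat as ℕ using (ℕ; zero; suc)
open import Data.Fin as F using (Fin; toℕ; _≟_)
open import Data.Vec using (Vec; lookup; tabulate)
open import Data.List using (List; []; _∷_; concat)
open import Data.List.Membership.Propositional using (_∈_)
open import Data.List.Relation.Unary.Unique.Propositional using (Unique)
open import Data.Product using (Σ; ∃; _×_; _,_)
open import Relation.Nullary using (¬_)
open import Relation.Nullary.Decidable using (⌊_⌋)
open import Relation.Binary.PropositionalEquality using (_≡_)

record Field (c ℓ : Level) : Set (Level.suc (c ⊔ ℓ)) where
  field
    commutativeRing : CommutativeRing c ℓ
  open CommutativeRing commutativeRing public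
  field
    1≉0     : ¬ (1# ≈ 0#)
    inverse : ∀ x → ¬ (x ≈ 0#) → ∃ λ y → (x * y) ≈ 1#

Digraph : ℕ → Set
Digraph V = Fin V → Fin V → Bool

Loopless : ∀ {V} → Digraph V → Set
Loopless G = ∀ x → G x x ≡ false

-- Edge subsets (spanning subgraphs, given by their edge sets), stored as a
-- Boolean matrix so that equality is structural.
EdgeSet : ℕ → Set
EdgeSet V = Vec (Vec Bool V) V

has : ∀ {V} → EdgeSet V → Fin V → Fin V → Bool
has T x y = lookup (lookup T x) y

remove : ∀ {V} → EdgeSet V → Fin V → Fin V → EdgeSet V
remove T x y = tabulate λ a → tabulate λ b →
  has T a b ∧ not (⌊ a ≟ x ⌋ ∧ ⌊ b ≟ y ⌋)

sumℕ : ∀ {n} → (Fin n → ℕ) → ℕ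
sumℕ {zero}  f = 0
sumℕ {suc n} f = f F.zero ℕ.+ sumℕ (λ i → f (F.suc i))

size : ∀ {V} → EdgeSet V → ℕ
size T = sumℕ λ a → sumℕ λ b → if has T a b then 1 else 0

-- Fixed total order on V × V (hence on E(G)): lexicographic,
-- (a , b) ↦ a * V + b.
index : ∀ {V} → Fin V → Fin V → ℕ
index {V} a b = toℕ a ℕ.* V ℕ.+ toℕ b

-- ε(H , H ∪ e) for e = (x , y): number of edges of H preceding e
ε : ∀ {V} → EdgeSet V → Fin V → Fin V → ℕ
ε H x y = sumℕ λ a → sumℕ λ b →
  if has H a b ∧ ⌊ index a b ℕ.<? index x y ⌋ then 1 else 0

data Consec {A : Set} : List A → A → A → Set where
  here  : ∀ {x y xs} → Consec (x ∷ y ∷ xs) x y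
  there : ∀ {z xs x y} → Consec xs x y → Consec (z ∷ xs) x y

-- T is a multipath of G: T ⊆ E(G), and the edges of T are exactly the
-- edges of a family of pairwise vertex-disjoint simple directed paths
-- (each path given by its list of vertices; Unique (concat paths) says no
-- vertex is repeated within a path nor shared between two paths, so no
-- path is a cycle).  The remaining vertices are the one-vertex components.
record IsMultipath {V} (G : Digraph V) (T : EdgeSet V) : Set where
  field
    sub      : ∀ x y → has T x y ≡ true → G x y ≡ true
    paths    : List (List (Fin V))
    disjoint : Unique (concat paths)
    sound    : ∀ {P} → P ∈ paths → ∀ {x y} → Consec P x y → has T x y ≡ true
    complete : ∀ x y → has T x y ≡ true → Σ (List (Fin V)) λ P → P ∈ paths × Consec P x y

-- Multipath cochain complex over a field K.  A cochain is a function
-- c : EdgeSet V → K, i.e. c = Σ_H c(H) b_H; it lies in C^n_μ(G;K) iff it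
-- vanishes off the multipaths of G with n edges.

module Cochains {c ℓ} (K : Field c ℓ) where
  open Field K

  sumK : ∀ {n} → (Fin n → Carrier) → Carrier
  sumK {zero}  f = 0#
  sumK {suc n} f = f F.zero + sumK (λ i → f (F.suc i))

  sign : ℕ → Carrier
  sign zero    = 1#
  sign (suc k) = - sign k

  IsCochain : ∀ {V} → Digraph V → ℕ → (EdgeSet V → Carrier) → Set ℓ
  IsCochain G n f = ∀ T → ¬ (IsMultipath G T × size T ≡ n) → f T ≈ 0#

  -- coefficient of b_T in d f (for T a multipath of G):
  -- Σ_{e ∈ T} (-1)^{ε(T∖e , T)} f(T ∖ e)
  -- (cochains vanish off multipaths, so only multipaths T∖e contribute)
  dCoeff : ∀ {V} → (EdgeSet V → Carrier) → EdgeSet V → Carrier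
  dCoeff f T = sumK λ x → sumK λ y →
    if has T x y then sign (ε (remove T x y) x y) * f (remove T x y) else 0#

  -- d f ≈ g, for g a cochain (coefficients at non-multipaths are 0)
  _IsCoboundaryOf_inGraph_ : ∀ {V} → (EdgeSet V → Carrier) → (EdgeSet V → Carrier) → Digraph V → Set ℓ
  g IsCoboundaryOf f inGraph G = ∀ T → IsMultipath G T → g T ≈ dCoeff f T

  IsCocycle : ∀ {V} → Digraph V → (EdgeSet V → Carrier) → Set ℓ
  IsCocycle G f = ∀ T → IsMultipath G T → dCoeff f T ≈ 0#

  HVanishes : ∀ {V} → Digraph V → Set (c ⊔ ℓ)
  HVanishes G =
    (∀ f → IsCochain G 0 f → IsCocycle G f → ∀ T → f T ≈ 0#) ×
    (∀ n f → IsCochain G (suc n) f → IsCocycle G f →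
       ∃ λ g → IsCochain G n g × (f IsCoboundaryOf g inGraph G))

delIn : ∀ {V} → Digraph V → Fin V → Digraph V
delIn G v x y = G x y ∧ not ⌊ y ≟ v ⌋

delOut : ∀ {V} → Digraph V → Fin V → Digraph V
delOut G v x y = G x y ∧ not ⌊ x ≟ v ⌋

addEdge : ∀ {V} → Digraph V → Fin V → Fin V → Digraph V
addEdge G a b x y = G x y ∨ (⌊ x ≟ a ⌋ ∧ ⌊ y ≟ b ⌋)

-- Let e₁ … e_k be the edges into v (or out of v), A = G ∖ {e₁ … e_k} and B_h = A ∪ e_h.
-- Since no multipath contains two of the e_h, the multipaths of G are those of A together
-- with, for each h, the multipaths of B_h through e_h.  Given a cocycle f of G, restrict it
-- to A and to each B_h and choose primitives g_A and g_h.  On A the two primitives differ by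
-- a cocycle, hence by a coboundary d q_h, and
--   g = g_A + Σ_h [e_h ∈ ·] (g_h + e_h ∧ q_h)
-- is a primitive of f on G: the term e_h ∧ q_h repairs the mismatch between g_A and g_h on
-- the face that drops e_h.  In degree 0 every multipath without edges already lies in A.
-- A set of edges is a multipath iff some duplicate-free vertex sequence contains each of its
-- edges as a pair of consecutive entries; this description makes edge removal and the
-- in/out-degree bounds immediate, and makes being a multipath decidable, as e_h ∧ q_h needs.

module Submission where

open import Defs
open import Data.Nat using (ℕ; _≤_)
open import Data.Fin using (Fin)
open import Data.Bool using (true)
open import Data.Product using (_×_; ∃)
open import Relation.Binary.PropositionalEquality using (_≡_)
open import Function.Definitions using (Injective)

open import Algebra.Bundles using (CommutativeMonoid)
open import Data.Bool using (Bool; false; if_then_else_; _∧_; _∨_; not)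
open import Data.Bool.Properties using (∧-comm; ∧-conicalˡ; ∧-identityʳ; ∧-zeroʳ; ∨-zeroʳ)
open import Data.Nat as ℕ using (zero; suc; _<?_)
import Data.Nat.Properties as ℕ
open import Data.Fin as Fin using (toℕ; _≟_; punchIn)
import Data.Fin.Properties as Fin
open import Data.Vec using (lookup; tabulate)
open import Data.Vec.Properties using (lookup∘tabulate; tabulate∘lookup; tabulate-cong)
open import Data.Product using (_,_; proj₁; proj₂)
open import Data.Product.Properties using (,-injective)
open import Data.Sum using (_⊎_; inj₁; inj₂; [_,_]′)
import Data.List
import Data.Bool
import Function.Properties.Equivalence
import Data.List.Relation.Unary.Unique.DecPropositional as UniqueDec
open import Data.List using (List; []; _∷_; _++_; concat; length; allFin; cartesianProductWith)
open import Data.List.Membership.Propositional using (_∈_; lose; find)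
open import Data.List.Membership.Propositional.Properties using (∈-allFin; ∈-cartesianProductWith⁺; ∈-lookup)
open import Data.List.Relation.Unary.All as All using (All; []; _∷_)
open import Data.List.Relation.Unary.Any as Any using (Any; here; there)
open import Data.List.Relation.Unary.Unique.Propositional using (Unique; []; _∷_)
open import Data.List.Relation.Unary.Unique.Propositional.Properties using (Unique[x∷xs]⇒x∉xs)
open import Function using (_∘_; _⇔_; mk⇔; Equivalence)
open import Relation.Binary using (tri<; tri≈; tri>)
open import Relation.Binary.PropositionalEquality as ≡ using (_≢_; module ≡-Reasoning)
open import Relation.Nullary using (¬_; ¬?; Dec; does; yes; no; contradiction)
open import Relation.Nullary.Decidable as Dec using (⌊_⌋; isYes≗does; dec-true; dec-false; _×-dec_; _⊎-dec_; _→-dec_)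

⌊⌋-true : ∀ {p} {P : Set p} (P? : Dec P) → P → ⌊ P? ⌋ ≡ true
⌊⌋-true P? p = ≡.trans (isYes≗does P?) (dec-true P? p)

⌊⌋-false : ∀ {p} {P : Set p} (P? : Dec P) → ¬ P → ⌊ P? ⌋ ≡ false
⌊⌋-false P? ¬p = ≡.trans (isYes≗does P?) (dec-false P? ¬p)

-- Finite sums in a commutative monoid

module FiniteSums {c ℓ} (M : CommutativeMonoid c ℓ) where
  open CommutativeMonoid M renaming (_∙_ to _⊕_; ε to 𝟘)
  open import Algebra.Properties.CommutativeMonoid.Sum M public
  open import Relation.Binary.Reasoning.Setoid setoid

  sum-update : ∀ {n} {f g : Fin n → Carrier} i d →
               (∀ j → j ≢ i → f j ≈ g j) → f i ≈ d ⊕ g i → sum f ≈ d ⊕ sum g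
  sum-update {suc n} {f} {g} i d f≈g fᵢ≈ = begin
    sum f                          ≈⟨ sum-remove f ⟩
    f i ⊕ sum (f ∘ punchIn i)      ≈⟨ ∙-cong fᵢ≈ (sum-cong-≋ (λ j → f≈g _ (Fin.punchInᵢ≢i i j))) ⟩
    (d ⊕ g i) ⊕ sum (g ∘ punchIn i) ≈⟨ assoc d (g i) _ ⟩
    d ⊕ (g i ⊕ sum (g ∘ punchIn i)) ≈⟨ ∙-congˡ (sum-remove g) ⟨
    d ⊕ sum g                      ∎

  sum-zero : ∀ {n} {f : Fin n → Carrier} → (∀ i → f i ≈ 𝟘) → sum f ≈ 𝟘
  sum-zero {n} f≈𝟘 = trans (sum-cong-≋ f≈𝟘) (sum-replicate-zero n)

  sum-single : ∀ {n} (f : Fin n → Carrier) i → (∀ j → j ≢ i → f j ≈ 𝟘) → sum f ≈ f i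
  sum-single {n} f i f≈𝟘 = begin
    sum f                   ≈⟨ sum-update i (f i) f≈𝟘 (sym (identityʳ (f i))) ⟩
    f i ⊕ sum {n} (λ _ → 𝟘) ≈⟨ ∙-congˡ (sum-zero {n} λ _ → refl) ⟩
    f i ⊕ 𝟘                 ≈⟨ identityʳ (f i) ⟩
    f i                     ∎

  ∑∑ : ∀ {m n} → (Fin m → Fin n → Carrier) → Carrier
  ∑∑ F = sum λ x → sum (F x)

  ∑∑-cong : ∀ {m n} {F G : Fin m → Fin n → Carrier} → (∀ x y → F x y ≈ G x y) → ∑∑ F ≈ ∑∑ G
  ∑∑-cong F≈G = sum-cong-≋ λ x → sum-cong-≋ (F≈G x)

  ∑∑-distrib-⊕ : ∀ {m n} (F G : Fin m → Fin n → Carrier) → ∑∑ (λ x y → F x y ⊕ G x y) ≈ ∑∑ F ⊕ ∑∑ G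
  ∑∑-distrib-⊕ F G = trans (sum-cong-≋ λ x → ∑-distrib-+ (F x) (G x)) (∑-distrib-+ (λ x → sum (F x)) (λ x → sum (G x)))

  ∑∑-update : ∀ {m n} {F G : Fin m → Fin n → Carrier} a b d →
              (∀ x y → (x , y) ≢ (a , b) → F x y ≈ G x y) → F a b ≈ d ⊕ G a b → ∑∑ F ≈ d ⊕ ∑∑ G
  ∑∑-update a b d F≈G Fab≈ = sum-update a d
    (λ x x≢a → sum-cong-≋ λ y → F≈G x y (x≢a ∘ proj₁ ∘ ,-injective))
    (sum-update b d (λ y y≢b → F≈G a y (y≢b ∘ proj₂ ∘ ,-injective)) Fab≈)

  ∑∑-single : ∀ {m n} (F : Fin m → Fin n → Carrier) a b → (∀ x y → (x , y) ≢ (a , b) → F x y ≈ 𝟘) → ∑∑ F ≈ F a b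
  ∑∑-single F a b F≈𝟘 = trans
    (sum-single _ a λ x x≢a → sum-zero λ y → F≈𝟘 x y (x≢a ∘ proj₁ ∘ ,-injective))
    (sum-single _ b λ y y≢b → F≈𝟘 a y (y≢b ∘ proj₂ ∘ ,-injective))

module ℕ-Sums = FiniteSums ℕ.+-0-commutativeMonoid

sumℕ≡sum : ∀ {n} (f : Fin n → ℕ) → sumℕ f ≡ ℕ-Sums.sum f
sumℕ≡sum {zero}  f = ≡.refl
sumℕ≡sum {suc n} f = ≡.cong (f Fin.zero ℕ.+_) (sumℕ≡sum (f ∘ Fin.suc))

sumℕ²≡∑∑ : ∀ {m n} (F : Fin m → Fin n → ℕ) → sumℕ (λ a → sumℕ (F a)) ≡ ℕ-Sums.∑∑ F
sumℕ²≡∑∑ {m} F = ≡.trans (sumℕ≡sum {m} _) (ℕ-Sums.sum-cong-≋ λ a → sumℕ≡sum (F a))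

-- Edge sets

module _ {V : ℕ} where
  open Data.Nat using (_+_)

  has-remove : ∀ (T : EdgeSet V) x y a b → has (remove T x y) a b ≡ has T a b ∧ not (⌊ a ≟ x ⌋ ∧ ⌊ b ≟ y ⌋)
  has-remove T x y a b = ≡.trans (≡.cong (λ r → lookup r b) (lookup∘tabulate _ a)) (lookup∘tabulate _ b)

  has-remove-self : ∀ (T : EdgeSet V) x y → has (remove T x y) x y ≡ false
  has-remove-self T x y with x ≟ x | y ≟ y | has-remove T x y x y
  ... | yes _   | yes _   | eq = ≡.trans eq (∧-zeroʳ (has T x y))
  ... | no x≢x  | _       | _  = contradiction ≡.refl x≢x
  ... | yes _   | no y≢y  | _  = contradiction ≡.refl y≢y

  has-remove-other : ∀ (T : EdgeSet V) x y a b → (a , b) ≢ (x , y) → has (remove T x y) a b ≡ has T a b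
  has-remove-other T x y a b ab≢xy with a ≟ x | b ≟ y | has-remove T x y a b
  ... | yes ≡.refl | yes ≡.refl | _  = contradiction ≡.refl ab≢xy
  ... | yes _      | no _       | eq = ≡.trans eq (∧-identityʳ (has T a b))
  ... | no _       | _          | eq = ≡.trans eq (∧-identityʳ (has T a b))

  has-remove⇒has : ∀ (T : EdgeSet V) x y a b → has (remove T x y) a b ≡ true → has T a b ≡ true
  has-remove⇒has T x y a b h = ∧-conicalˡ _ _ (≡.trans (≡.sym (has-remove T x y a b)) h)

  edgeSet-ext : ∀ (T T′ : EdgeSet V) → (∀ a b → has T a b ≡ has T′ a b) → T ≡ T′
  edgeSet-ext T T′ eq = begin
    T                                          ≡⟨ tabulate∘lookup T ⟨
    tabulate (λ a → lookup T a)                ≡⟨ tabulate-cong (λ a → row a) ⟩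
    tabulate (λ a → lookup T′ a)               ≡⟨ tabulate∘lookup T′ ⟩
    T′                                         ∎
    where
    open ≡-Reasoning
    row : ∀ a → lookup T a ≡ lookup T′ a
    row a = ≡.trans (≡.sym (tabulate∘lookup (lookup T a)))
              (≡.trans (tabulate-cong (eq a)) (tabulate∘lookup (lookup T′ a)))

  remove-comm : ∀ (T : EdgeSet V) x y a b → remove (remove T x y) a b ≡ remove (remove T a b) x y
  remove-comm T x y a b = edgeSet-ext _ _ λ u w → begin
    has (remove (remove T x y) a b) u w        ≡⟨ has-remove (remove T x y) a b u w ⟩
    has (remove T x y) u w ∧ not (e u w a b)   ≡⟨ ≡.cong (_∧ not (e u w a b)) (has-remove T x y u w) ⟩
    (has T u w ∧ not (e u w x y)) ∧ not (e u w a b) ≡⟨ swap (has T u w) _ _ ⟩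
    (has T u w ∧ not (e u w a b)) ∧ not (e u w x y) ≡⟨ ≡.cong (_∧ not (e u w x y)) (has-remove T a b u w) ⟨
    has (remove T a b) u w ∧ not (e u w x y)   ≡⟨ has-remove (remove T a b) x y u w ⟨
    has (remove (remove T a b) x y) u w        ∎
    where
    open ≡-Reasoning
    e : Fin V → Fin V → Fin V → Fin V → Bool
    e u w x y = ⌊ u ≟ x ⌋ ∧ ⌊ w ≟ y ⌋
    swap : ∀ p q r → (p ∧ q) ∧ r ≡ (p ∧ r) ∧ q
    swap false _ _ = ≡.refl
    swap true  q r = ∧-comm q r

  count : Bool → ℕ
  count b = if b then 1 else 0

  size-remove : ∀ (T : EdgeSet V) x y → has T x y ≡ true → size T ≡ suc (size (remove T x y))
  size-remove T x y h = begin
    size T                         ≡⟨ sumℕ²≡∑∑ (edges T) ⟩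
    ∑∑ (edges T)                   ≡⟨ ∑∑-update x y 1 (λ a b ab≢xy → ≡.cong count (≡.sym (has-remove-other T x y a b ab≢xy))) at-xy ⟩
    1 + ∑∑ (edges (remove T x y))  ≡⟨ ≡.cong suc (sumℕ²≡∑∑ (edges (remove T x y))) ⟨
    suc (size (remove T x y))      ∎
    where
    open ≡-Reasoning
    open ℕ-Sums using (∑∑; ∑∑-update)
    edges : EdgeSet V → Fin V → Fin V → ℕ
    edges T a b = count (has T a b)
    at-xy : edges T x y ≡ 1 + edges (remove T x y) x y
    at-xy = ≡.trans (≡.cong count h) (≡.cong (λ p → 1 + count p) (≡.sym (has-remove-self T x y)))

  index-injective : ∀ (a b x y : Fin V) → index a b ≡ index x y → (a , b) ≡ (x , y)
  index-injective a b x y eq = ≡.cong₂ _,_ (proj₁ combine≡) (proj₂ combine≡)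
    where
    open ≡-Reasoning
    toℕ-combine : ∀ (a b : Fin V) → toℕ (Fin.combine a b) ≡ index a b
    toℕ-combine a b = ≡.trans (Fin.toℕ-combine a b) (≡.cong (_+ toℕ b) (ℕ.*-comm V (toℕ a)))
    combine≡ = Fin.combine-injective a b x y (Fin.toℕ-injective (begin
      toℕ (Fin.combine a b) ≡⟨ toℕ-combine a b ⟩
      index a b             ≡⟨ eq ⟩
      index x y             ≡⟨ toℕ-combine x y ⟨
      toℕ (Fin.combine x y) ∎))

  precedes : Fin V → Fin V → Fin V → Fin V → Bool
  precedes a b x y = ⌊ index a b <? index x y ⌋

  precedes-trichotomy : ∀ a b x y → (a , b) ≢ (x , y) →
    (precedes a b x y ≡ true × precedes x y a b ≡ false) ⊎ (precedes a b x y ≡ false × precedes x y a b ≡ true)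
  precedes-trichotomy a b x y ab≢xy with ℕ.<-cmp (index a b) (index x y)
  ... | tri< ab<xy _ xy≮ab = inj₁ (⌊⌋-true (index a b <? index x y) ab<xy , ⌊⌋-false (index x y <? index a b) xy≮ab)
  ... | tri≈ _ ab≡xy _     = contradiction (index-injective a b x y ab≡xy) ab≢xy
  ... | tri> ab≮xy _ xy<ab = inj₂ (⌊⌋-false (index a b <? index x y) ab≮xy , ⌊⌋-true (index x y <? index a b) xy<ab)

  ε-remove : ∀ (H : EdgeSet V) a b x y → has H a b ≡ true → ε H x y ≡ count (precedes a b x y) + ε (remove H a b) x y
  ε-remove H a b x y h = begin
    ε H x y                                               ≡⟨ sumℕ²≡∑∑ (earlier H) ⟩
    ∑∑ (earlier H)                                        ≡⟨ ∑∑-update a b _ (λ u w uw≢ab → ≡.cong (λ p → count (p ∧ precedes u w x y))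
                                                                                (≡.sym (has-remove-other H a b u w uw≢ab))) at-ab ⟩
    count (precedes a b x y) + ∑∑ (earlier (remove H a b)) ≡⟨ ≡.cong (count (precedes a b x y) +_) (sumℕ²≡∑∑ (earlier (remove H a b))) ⟨
    count (precedes a b x y) + ε (remove H a b) x y       ∎
    where
    open ≡-Reasoning
    open ℕ-Sums using (∑∑; ∑∑-update)
    earlier : EdgeSet V → Fin V → Fin V → ℕ
    earlier H u w = count (has H u w ∧ precedes u w x y)
    at-ab : earlier H a b ≡ count (precedes a b x y) + earlier (remove H a b) a b
    at-ab = begin
      earlier H a b                                        ≡⟨ ≡.cong (λ p → count (p ∧ precedes a b x y)) h ⟩
      count (precedes a b x y)                             ≡⟨ ℕ.+-identityʳ _ ⟨
      count (precedes a b x y) + 0                         ≡⟨ ≡.cong (λ p → count (precedes a b x y) + count (p ∧ precedes a b x y))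
                                                               (has-remove-self H a b) ⟨
      count (precedes a b x y) + earlier (remove H a b) a b ∎

-- Consecutive entries of lists

module _ {A : Set} where

  Consec-++ˡ : ∀ {xs a b} (ys : List A) → Consec xs a b → Consec (xs ++ ys) a b
  Consec-++ˡ ys here      = here
  Consec-++ˡ ys (there c) = there (Consec-++ˡ ys c)

  Consec-++ʳ : ∀ (xs : List A) {ys a b} → Consec ys a b → Consec (xs ++ ys) a b
  Consec-++ʳ []       c = c
  Consec-++ʳ (x ∷ xs) c = there (Consec-++ʳ xs c)

  Consec-concat : ∀ {ps : List (List A)} {P a b} → P ∈ ps → Consec P a b → Consec (concat ps) a b
  Consec-concat {P ∷ ps} (here ≡.refl) c = Consec-++ˡ (concat ps) c
  Consec-concat {P ∷ ps} (there P∈ps)  c = Consec-++ʳ P (Consec-concat P∈ps c)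

  Consec⇒fst∈ : ∀ {xs} {a b : A} → Consec xs a b → a ∈ xs
  Consec⇒fst∈ here      = here ≡.refl
  Consec⇒fst∈ (there c) = there (Consec⇒fst∈ c)

  Consec⇒snd∈tail : ∀ {z xs} {a b : A} → Consec (z ∷ xs) a b → b ∈ xs
  Consec⇒snd∈tail here                    = here ≡.refl
  Consec⇒snd∈tail {xs = _ ∷ _} (there c)  = there (Consec⇒snd∈tail c)

  Consec-unique-pred : ∀ {xs} {a b c : A} → Unique xs → Consec xs a c → Consec xs b c → a ≡ b
  Consec-unique-pred _                 here       here        = ≡.refl
  Consec-unique-pred (_ ∷ u)           here       (there c′)  = contradiction (Consec⇒snd∈tail c′) (Unique[x∷xs]⇒x∉xs u)
  Consec-unique-pred (_ ∷ u)           (there c)  here        = contradiction (Consec⇒snd∈tail c) (Unique[x∷xs]⇒x∉xs u)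
  Consec-unique-pred (_ ∷ u)           (there c)  (there c′)  = Consec-unique-pred u c c′

  Consec-unique-succ : ∀ {xs} {a b c : A} → Unique xs → Consec xs a b → Consec xs a c → b ≡ c
  Consec-unique-succ _                 here       here        = ≡.refl
  Consec-unique-succ u@(_ ∷ _)         here       (there c′)  = contradiction (Consec⇒fst∈ c′) (Unique[x∷xs]⇒x∉xs u)
  Consec-unique-succ u@(_ ∷ _)         (there c)  here        = contradiction (Consec⇒fst∈ c) (Unique[x∷xs]⇒x∉xs u)
  Consec-unique-succ (_ ∷ u)           (there c)  (there c′)  = Consec-unique-succ u c c′

  consec? : (∀ (a b : A) → Dec (a ≡ b)) → ∀ xs a b → Dec (Consec xs a b)
  consec? _≟ᴬ_ []          a b = no λ ()
  consec? _≟ᴬ_ (x ∷ [])    a b = no λ { (there ()) }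
  consec? _≟ᴬ_ (x ∷ y ∷ r) a b = Dec.map′
    (λ { (inj₁ (≡.refl , ≡.refl)) → here ; (inj₂ c) → there c })
    (λ { here → inj₁ (≡.refl , ≡.refl) ; (there c) → inj₂ c })
    (((x ≟ᴬ a) ×-dec (y ≟ᴬ b)) ⊎-dec consec? _≟ᴬ_ (y ∷ r) a b)

module Cut {A : Set} (link : A → A → Bool) where

  private
    attach : Bool → A → List A × List (List A) → List A × List (List A)
    attach true  b (P , Ps) = b ∷ P , Ps
    attach false b (P , Ps) = [] , (b ∷ P) ∷ Ps

    pieces : A → List A → List A × List (List A)
    pieces a []      = [] , []
    pieces a (b ∷ r) = attach (link a b) b (pieces b r)

  -- cut xs breaks xs between consecutive entries a , b unless link a b
  cut : List A → List (List A)
  cut []      = []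
  cut (a ∷ r) = (a ∷ proj₁ (pieces a r)) ∷ proj₂ (pieces a r)

  concat-cut : ∀ xs → concat (cut xs) ≡ xs
  concat-cut []      = ≡.refl
  concat-cut (a ∷ r) = ≡.cong (a ∷_) (glue a r)
    where
    glue : ∀ a r → proj₁ (pieces a r) ++ concat (proj₂ (pieces a r)) ≡ r
    glue a []      = ≡.refl
    glue a (b ∷ r) with link a b | pieces b r | glue b r
    ... | true  | P , Ps | eq = ≡.cong (b ∷_) eq
    ... | false | P , Ps | eq = ≡.cong (b ∷_) eq

  Linked : List A → Set
  Linked Q = ∀ {a b} → Consec Q a b → link a b ≡ true

  cut-linked : ∀ xs → All Linked (cut xs)
  cut-linked []      = []
  cut-linked (a ∷ r) = let (first , rest) = go a r in first ∷ rest
    where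
    go : ∀ a r → Linked (a ∷ proj₁ (pieces a r)) × All Linked (proj₂ (pieces a r))
    go a []      = (λ { (there ()) }) , []
    go a (b ∷ r) with link a b in ab | pieces b r | go b r
    ... | true  | P , Ps | first , rest = (λ { here → ab ; (there c) → first c }) , rest
    ... | false | P , Ps | first , rest = (λ { (there ()) }) , first ∷ rest

  cut-complete : ∀ xs {a b} → Consec xs a b → link a b ≡ true → Any (λ Q → Consec Q a b) (cut xs)
  cut-complete (a ∷ []) (there ()) _
  cut-complete (a ∷ b ∷ r) c ab with link a b in eq | pieces b r | cut-complete (b ∷ r)
  cut-complete (a ∷ b ∷ r) here      ab | true  | P , Ps | ih = here here
  cut-complete (a ∷ b ∷ r) (there c) ab | true  | P , Ps | ih with ih c ab
  ... | here c′  = here (there c′)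
  ... | there c′ = there c′
  cut-complete (a ∷ b ∷ r) here      ab | false | P , Ps | ih = contradiction (≡.trans (≡.sym ab) eq) λ ()
  cut-complete (a ∷ b ∷ r) (there c) ab | false | P , Ps | ih = there (ih c ab)

-- Multipaths

module _ {V : ℕ} where

  EdgesIn : EdgeSet V → Digraph V → Set
  EdgesIn T G = ∀ x y → has T x y ≡ true → G x y ≡ true

  Covers : EdgeSet V → List (Fin V) → Set
  Covers T xs = ∀ x y → has T x y ≡ true → Consec xs x y

  Linearisable : EdgeSet V → Set
  Linearisable T = ∃ λ xs → Unique xs × Covers T xs

  -- The paths of a multipath are recovered from any duplicate-free
  -- vertex sequence covering its edges by cutting it at the non-edges.
  multipath⇔ : ∀ {G : Digraph V} {T} → IsMultipath G T ⇔ (EdgesIn T G × Linearisable T)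
  multipath⇔ {G} {T} = mk⇔ to from
    where
    to : IsMultipath G T → EdgesIn T G × Linearisable T
    to m = sub , concat paths , disjoint , λ x y h → let (P , P∈ , c) = complete x y h in Consec-concat P∈ c
      where open IsMultipath m
    from : EdgesIn T G × Linearisable T → IsMultipath G T
    from (sub , xs , u , cov) = record
      { sub      = sub
      ; paths    = cut xs
      ; disjoint = ≡.subst Unique (≡.sym (concat-cut xs)) u
      ; sound    = All.lookup (cut-linked xs)
      ; complete = λ x y h → find (cut-complete xs (cov x y h) h)
      }
      where open Cut (has T)

  multipath-mono : ∀ {G G′ : Digraph V} {T} → IsMultipath G T → EdgesIn T G′ → IsMultipath G′ T
  multipath-mono m sub′ = record { IsMultipath m; sub = sub′ }

  multipath-remove : ∀ {G : Digraph V} {T} → IsMultipath G T → ∀ x y → IsMultipath G (remove T x y)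
  multipath-remove {T = T} m x y with Equivalence.to multipath⇔ m
  ... | sub , xs , u , cov = Equivalence.from multipath⇔
    ( (λ a b h → sub a b (has-remove⇒has T x y a b h))
    , xs , u , λ a b h → cov a b (has-remove⇒has T x y a b h))

  multipath-in-unique : ∀ {G : Digraph V} {T x x′ v} → IsMultipath G T →
                        has T x v ≡ true → has T x′ v ≡ true → x ≡ x′
  multipath-in-unique m h h′ with Equivalence.to multipath⇔ m
  ... | _ , _ , u , cov = Consec-unique-pred u (cov _ _ h) (cov _ _ h′)

  multipath-out-unique : ∀ {G : Digraph V} {T v y y′} → IsMultipath G T →
                         has T v y ≡ true → has T v y′ ≡ true → y ≡ y′
  multipath-out-unique m h h′ with Equivalence.to multipath⇔ m
  ... | _ , _ , u , cov = Consec-unique-succ u (cov _ _ h) (cov _ _ h′)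

  vertexLists : ℕ → List (List (Fin V))
  vertexLists zero    = [] ∷ []
  vertexLists (suc n) = [] ∷ cartesianProductWith _∷_ (allFin V) (vertexLists n)

  ∈-vertexLists : ∀ {n} (xs : List (Fin V)) → length xs ≤ n → xs ∈ vertexLists n
  ∈-vertexLists {zero}  []       _         = here ≡.refl
  ∈-vertexLists {suc n} []       _         = here ≡.refl
  ∈-vertexLists {suc n} (x ∷ xs) (ℕ.s≤s l) = there (∈-cartesianProductWith⁺ _∷_ (∈-allFin x) (∈-vertexLists xs l))

  unique⇒length≤ : ∀ {xs : List (Fin V)} → Unique xs → length xs ≤ V
  unique⇒length≤ {xs} u with length xs ℕ.≤? V
  ... | yes l = l
  ... | no l  = let (i , j , i<j , eq) = Fin.pigeonhole (ℕ.≰⇒> l) (Data.List.lookup xs)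
                in  contradiction (lookup-injective u i j eq) (Fin.<⇒≢ i<j)
    where
    lookup-injective : ∀ {xs : List (Fin V)} → Unique xs → ∀ i j → Data.List.lookup xs i ≡ Data.List.lookup xs j → i ≡ j
    lookup-injective (_ ∷ _)   Fin.zero    Fin.zero    _  = ≡.refl
    lookup-injective (x∉ ∷ _)  Fin.zero    (Fin.suc j) eq = contradiction eq (All.lookup x∉ (∈-lookup j))
    lookup-injective (x∉ ∷ _)  (Fin.suc i) Fin.zero    eq = contradiction (≡.sym eq) (All.lookup x∉ (∈-lookup i))
    lookup-injective (_ ∷ u)   (Fin.suc i) (Fin.suc j) eq = ≡.cong Fin.suc (lookup-injective u i j eq)

  multipath? : ∀ (G : Digraph V) T → Dec (IsMultipath G T)
  multipath? G T = Dec.map (Function.Properties.Equivalence.sym multipath⇔) (edgesIn? ×-dec linearisable?)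
    where
    edge? : ∀ (G : Fin V → Fin V → Bool) x y → Dec (G x y ≡ true)
    edge? G x y = G x y Data.Bool.≟ true
    edgesIn? : Dec (EdgesIn T G)
    edgesIn? = Fin.all? λ x → Fin.all? λ y → edge? (has T) x y →-dec edge? G x y
    covers? : ∀ xs → Dec (Covers T xs)
    covers? xs = Fin.all? λ x → Fin.all? λ y → edge? (has T) x y →-dec consec? _≟_ xs x y
    linearisable? : Dec (Linearisable T)
    linearisable? = Dec.map′ Any.satisfied (λ (xs , u , cov) → lose (∈-vertexLists xs (unique⇒length≤ u)) (u , cov))
      (Any.any? (λ xs → UniqueDec.unique? _≟_ xs ×-dec covers? xs) (vertexLists V))

-- Cochains over a field

module CochainAlgebra {c ℓ} (K : Field c ℓ) where
  open Field K
  open Cochains K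
  open import Algebra.Properties.Semiring.Sum semiring
    using (sum; sum-cong-≋; ∑-comm; *-distribˡ-sum)
  open FiniteSums +-commutativeMonoid using (sum-zero; ∑∑; ∑∑-cong; ∑∑-distrib-⊕; ∑∑-single)
  open import Algebra.Properties.Ring ring using (-‿distribˡ-*; -‿involutive)
  open import Relation.Binary.Reasoning.Setoid setoid

  sumK≈sum : ∀ {n} (f : Fin n → Carrier) → sumK f ≈ sum f
  sumK≈sum {zero}  f = refl
  sumK≈sum {suc n} f = +-congˡ (sumK≈sum (f ∘ Fin.suc))

  module _ {V : ℕ} where

    Cochain : Set c
    Cochain = EdgeSet V → Carrier

    faceSign : EdgeSet V → Fin V → Fin V → Carrier
    faceSign T x y = sign (ε (remove T x y) x y)

    dTerm : Cochain → EdgeSet V → Fin V → Fin V → Carrier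
    dTerm f T x y = if has T x y then faceSign T x y * f (remove T x y) else 0#

    dCoeff≈∑∑ : ∀ f T → dCoeff f T ≈ ∑∑ (dTerm f T)
    dCoeff≈∑∑ f T = trans (sumK≈sum {V} _) (sum-cong-≋ λ x → sumK≈sum (dTerm f T x))

    dCoeff-cong : ∀ (f g : Cochain) T → (∀ x y → has T x y ≡ true → f (remove T x y) ≈ g (remove T x y)) →
                  dCoeff f T ≈ dCoeff g T
    dCoeff-cong f g T f≈g = begin
      dCoeff f T     ≈⟨ dCoeff≈∑∑ f T ⟩
      ∑∑ (dTerm f T) ≈⟨ ∑∑-cong (λ x y → term x y (has T x y) ≡.refl) ⟩
      ∑∑ (dTerm g T) ≈⟨ dCoeff≈∑∑ g T ⟨
      dCoeff g T     ∎
      where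
      term : ∀ x y b → has T x y ≡ b → (if b then faceSign T x y * f (remove T x y) else 0#)
                                       ≈ (if b then faceSign T x y * g (remove T x y) else 0#)
      term x y true  h = *-congˡ (f≈g x y h)
      term x y false _ = refl

    dCoeff-zero : ∀ (f : Cochain) T → (∀ x y → has T x y ≡ true → f (remove T x y) ≈ 0#) → dCoeff f T ≈ 0#
    dCoeff-zero f T f≈0 = begin
      dCoeff f T                  ≈⟨ dCoeff-cong f (λ _ → 0#) T f≈0 ⟩
      dCoeff (λ _ → 0#) T         ≈⟨ dCoeff≈∑∑ (λ _ → 0#) T ⟩
      ∑∑ (dTerm (λ _ → 0#) T)     ≈⟨ sum-zero (λ x → sum-zero λ y → term (has T x y) {faceSign T x y}) ⟩
      0#                          ∎
      where
      term : ∀ b {s} → (if b then s * 0# else 0#) ≈ 0#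
      term true  = zeroʳ _
      term false = refl

    dCoeff-single : ∀ (f : Cochain) T a b → has T a b ≡ true →
                    (∀ x y → has T x y ≡ true → (x , y) ≢ (a , b) → f (remove T x y) ≈ 0#) →
                    dCoeff f T ≈ faceSign T a b * f (remove T a b)
    dCoeff-single f T a b hab f≈0 = begin
      dCoeff f T      ≈⟨ dCoeff≈∑∑ f T ⟩
      ∑∑ (dTerm f T)  ≈⟨ ∑∑-single (dTerm f T) a b (λ x y xy≢ab → term x y xy≢ab (has T x y) ≡.refl) ⟩
      dTerm f T a b   ≡⟨ ≡.cong (λ h → if h then faceSign T a b * f (remove T a b) else 0#) hab ⟩
      faceSign T a b * f (remove T a b) ∎
      where
      term : ∀ x y → (x , y) ≢ (a , b) → ∀ h → has T x y ≡ h → (if h then faceSign T x y * f (remove T x y) else 0#) ≈ 0#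
      term x y xy≢ab true  h = trans (*-congˡ (f≈0 x y h xy≢ab)) (zeroʳ _)
      term x y xy≢ab false _ = refl

    dCoeff-+ : ∀ (f g : Cochain) T → dCoeff (λ X → f X + g X) T ≈ dCoeff f T + dCoeff g T
    dCoeff-+ f g T = begin
      dCoeff (λ X → f X + g X) T              ≈⟨ dCoeff≈∑∑ (λ X → f X + g X) T ⟩
      ∑∑ (dTerm (λ X → f X + g X) T)          ≈⟨ ∑∑-cong (λ x y → term (has T x y)) ⟩
      ∑∑ (λ x y → dTerm f T x y + dTerm g T x y) ≈⟨ ∑∑-distrib-⊕ (dTerm f T) (dTerm g T) ⟩
      ∑∑ (dTerm f T) + ∑∑ (dTerm g T)         ≈⟨ +-cong (dCoeff≈∑∑ f T) (dCoeff≈∑∑ g T) ⟨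
      dCoeff f T + dCoeff g T                 ∎
      where
      term : ∀ b {s u v} → (if b then s * (u + v) else 0#) ≈ (if b then s * u else 0#) + (if b then s * v else 0#)
      term true  = distribˡ _ _ _
      term false = sym (+-identityʳ 0#)

    dCoeff-- : ∀ (f g : Cochain) T → dCoeff (λ X → f X - g X) T ≈ dCoeff f T - dCoeff g T
    dCoeff-- f g T = x≈z//y _ _ _ (begin
      dCoeff (λ X → f X - g X) T + dCoeff g T ≈⟨ dCoeff-+ (λ X → f X - g X) g T ⟨
      dCoeff (λ X → f X - g X + g X) T        ≈⟨ dCoeff-cong (λ X → f X - g X + g X) f T (λ x y _ → //-rightDividesˡ (g (remove T x y)) (f (remove T x y))) ⟩
      dCoeff f T                              ∎)
      where open import Algebra.Properties.Group +-group using (x≈z//y; //-rightDividesˡ)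

    dCoeff-sum : ∀ {k} (F : Fin k → Cochain) T → dCoeff (λ X → sum λ j → F j X) T ≈ sum λ j → dCoeff (F j) T
    dCoeff-sum {k} F T = begin
      dCoeff (λ X → sum λ j → F j X) T             ≈⟨ dCoeff≈∑∑ (λ X → sum λ j → F j X) T ⟩
      ∑∑ (dTerm (λ X → sum λ j → F j X) T)         ≈⟨ ∑∑-cong (λ x y → term (has T x y)) ⟩
      ∑∑ (λ x y → sum λ j → dTerm (F j) T x y)     ≈⟨ sum-cong-≋ (λ x → ∑-comm (λ y j → dTerm (F j) T x y)) ⟩
      sum (λ x → sum λ j → sum λ y → dTerm (F j) T x y) ≈⟨ ∑-comm (λ x j → sum λ y → dTerm (F j) T x y) ⟩
      sum (λ j → ∑∑ (dTerm (F j) T))               ≈⟨ sum-cong-≋ (λ j → dCoeff≈∑∑ (F j) T) ⟨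
      sum (λ j → dCoeff (F j) T)                   ∎
      where
      term : ∀ b {s} {u : Fin k → Carrier} → (if b then s * sum u else 0#) ≈ sum λ j → if b then s * u j else 0#
      term true  {s} {u} = *-distribˡ-sum {k} s u
      term false = sym (sum-zero {k} λ _ → refl)

    -- One of the two edges precedes the other, so the two orders of removal differ by one sign.
    faceSign-swap : ∀ T x y a b → has T x y ≡ true → has T a b ≡ true → (x , y) ≢ (a , b) →
                    faceSign T x y * faceSign (remove T x y) a b ≈ - faceSign T a b * faceSign (remove T a b) x y
    faceSign-swap T x y a b hxy hab xy≢ab
      rewrite ε-remove (remove T x y) a b x y (≡.trans (has-remove-other T x y a b (xy≢ab ∘ ≡.sym)) hab)
            | ε-remove (remove T a b) x y a b (≡.trans (has-remove-other T a b x y xy≢ab) hxy)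
            | remove-comm T a b x y
      with precedes-trichotomy a b x y (xy≢ab ∘ ≡.sym)
    ... | inj₁ (p , q) rewrite p | q = begin
      - σ₁ * σ₂   ≈⟨ -‿distribˡ-* σ₁ σ₂ ⟨
      - (σ₁ * σ₂) ≈⟨ -‿cong (*-comm σ₁ σ₂) ⟩
      - (σ₂ * σ₁) ≈⟨ -‿distribˡ-* σ₂ σ₁ ⟩
      - σ₂ * σ₁   ∎
      where
      σ₁ = sign (ε (remove (remove T x y) a b) x y)
      σ₂ = sign (ε (remove (remove T x y) a b) a b)
    ... | inj₂ (p , q) rewrite p | q = begin
      σ₁ * σ₂     ≈⟨ *-comm σ₁ σ₂ ⟩
      σ₂ * σ₁     ≈⟨ *-congʳ (-‿involutive σ₂) ⟨
      - - σ₂ * σ₁ ∎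
      where
      σ₁ = sign (ε (remove (remove T x y) a b) x y)
      σ₂ = sign (ε (remove (remove T x y) a b) a b)

    restrict : {P : EdgeSet V → Set} → (∀ X → Dec (P X)) → Cochain → Cochain
    restrict P? f X = if does (P? X) then f X else 0#

    module _ {P : EdgeSet V → Set} (P? : ∀ X → Dec (P X)) (f : Cochain) where

      restrict-≈ : ∀ {X} → P X → restrict P? f X ≈ f X
      restrict-≈ {X} p rewrite dec-true (P? X) p = refl

      restrict-vanishes : ∀ {X} → (P X → f X ≈ 0#) → restrict P? f X ≈ 0#
      restrict-vanishes {X} f≈0 with P? X
      ... | yes p = f≈0 p
      ... | no _  = refl

      restrict-split : ∀ X → f X ≈ restrict P? f X + restrict (¬? ∘ P?) f X
      restrict-split X with does (P? X)
      ... | true  = sym (+-identityʳ (f X))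
      ... | false = sym (+-identityˡ (f X))

      dCoeff-restrict : ∀ T → (∀ x y → has T x y ≡ true → P (remove T x y)) → dCoeff (restrict P? f) T ≈ dCoeff f T
      dCoeff-restrict T P-faces = dCoeff-cong (restrict P? f) f T λ x y h → restrict-≈ (P-faces x y h)

      restrict-cochain : ∀ {G G′ : Digraph V} {m} → (∀ T → IsMultipath G T → P T → IsMultipath G′ T) →
                         IsCochain G m f → IsCochain G′ m (restrict P? f)
      restrict-cochain G⇒G′ f-cochain T ¬T = restrict-vanishes λ p → f-cochain T λ (mp , size≡) → ¬T (G⇒G′ T mp p , size≡)

      restrict-cocycle : ∀ {G G′ : Digraph V} → (∀ T → IsMultipath G′ T → IsMultipath G T) →
                         (∀ T → IsMultipath G′ T → P T) → (∀ T x y → P T → P (remove T x y)) →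
                         IsCocycle G f → IsCocycle G′ (restrict P? f)
      restrict-cocycle G′⇒G G′⇒P P-remove f-cocycle T mp = begin
        dCoeff (restrict P? f) T ≈⟨ dCoeff-restrict T (λ x y _ → P-remove T x y (G′⇒P T mp)) ⟩
        dCoeff f T               ≈⟨ f-cocycle T (G′⇒G T mp) ⟩
        0#                       ∎

    cochain-mono : ∀ {G G′ : Digraph V} {m f} → (∀ T → IsMultipath G′ T → IsMultipath G T) →
                   IsCochain G′ m f → IsCochain G m f
    cochain-mono G′⇒G f-cochain T ¬T = f-cochain T λ (mp , size≡) → ¬T (G′⇒G T mp , size≡)

    cochain-+ : ∀ {G : Digraph V} {m f g} → IsCochain G m f → IsCochain G m g → IsCochain G m (λ X → f X + g X)
    cochain-+ f-cochain g-cochain T ¬T = trans (+-cong (f-cochain T ¬T) (g-cochain T ¬T)) (+-identityʳ 0#)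

    cochain-- : ∀ {G : Digraph V} {m f g} → IsCochain G m f → IsCochain G m g → IsCochain G m (λ X → f X - g X)
    cochain-- f-cochain g-cochain T ¬T = trans (+-cong (f-cochain T ¬T) (-‿cong (g-cochain T ¬T))) (-‿inverseʳ 0#)

    cochain-sum : ∀ {G : Digraph V} {m k} {F : Fin k → Cochain} → (∀ j → IsCochain G m (F j)) →
                  IsCochain G m (λ X → sum λ j → F j X)
    cochain-sum F-cochain T ¬T = sum-zero λ j → F-cochain j T ¬T

    HasEdge : Fin V → Fin V → EdgeSet V → Set
    HasEdge a b X = has X a b ≡ true

    hasEdge? : ∀ a b X → Dec (HasEdge a b X)
    hasEdge? a b X = has X a b Data.Bool.≟ true

    ¬HasEdge-remove : ∀ T a b → ¬ HasEdge a b (remove T a b)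
    ¬HasEdge-remove T a b h with () ← ≡.trans (≡.sym (has-remove-self T a b)) h

    dCoeff-restrict-edge : ∀ (f : Cochain) T a b → has T a b ≡ true →
                           dCoeff f T ≈ dCoeff (restrict (hasEdge? a b) f) T + faceSign T a b * f (remove T a b)
    dCoeff-restrict-edge f T a b hab = begin
      dCoeff f T                               ≈⟨ dCoeff-cong f (λ X → with-ab X + without-ab X) T (λ x y _ → restrict-split (hasEdge? a b) f _) ⟩
      dCoeff (λ X → with-ab X + without-ab X) T ≈⟨ dCoeff-+ with-ab without-ab T ⟩
      dCoeff with-ab T + dCoeff without-ab T    ≈⟨ +-congˡ (dCoeff-single without-ab T a b hab λ x y _ xy≢ab →
                                                    restrict-vanishes (¬? ∘ hasEdge? a b) f λ ¬h → contradiction (≡.trans (has-remove-other T x y a b (xy≢ab ∘ ≡.sym)) hab) ¬h) ⟩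
      dCoeff with-ab T + faceSign T a b * without-ab (remove T a b) ≈⟨ +-congˡ (*-congˡ (restrict-≈ (¬? ∘ hasEdge? a b) f (¬HasEdge-remove T a b))) ⟩
      dCoeff with-ab T + faceSign T a b * f (remove T a b) ∎
      where
      with-ab without-ab : Cochain
      with-ab    = restrict (hasEdge? a b) f
      without-ab = restrict (¬? ∘ hasEdge? a b) f

    -- q has degree n − 1; for n = 0 this forces q ≈ 0
    IsCochainBelow : Digraph V → ℕ → Cochain → Set ℓ
    IsCochainBelow G n q = ∀ X → ¬ (IsMultipath G X × suc (size X) ≡ n) → q X ≈ 0#

    coneSupport? : ∀ (G : Digraph V) a b X → Dec (IsMultipath G X × HasEdge a b X)
    coneSupport? G a b X = multipath? G X ×-dec hasEdge? a b X

    coneValue : Fin V → Fin V → Cochain → Cochain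
    coneValue a b q X = faceSign X a b * q (remove X a b)

    -- e ∧ q for the edge e = (a , b), cut down to the multipaths of G
    cone : Digraph V → Fin V → Fin V → Cochain → Cochain
    cone G a b q = restrict (coneSupport? G a b) (coneValue a b q)

    cone-cochain : ∀ {G G′ : Digraph V} {n a b q} → IsCochainBelow G′ n q → IsCochain G n (cone G a b q)
    cone-cochain {G} {n = n} {a} {b} {q} q-below X ¬X =
      restrict-vanishes (coneSupport? G a b) (coneValue a b q) λ (mp , h) →
        trans (*-congˡ (q-below (remove X a b) λ (_ , size≡) → ¬X (mp , ≡.trans (size-remove X a b h) size≡))) (zeroʳ _)

    dCoeff-cone : ∀ {G : Digraph V} {T} q a b → IsMultipath G T → has T a b ≡ true →
                  dCoeff (cone G a b q) T ≈ - faceSign T a b * dCoeff q (remove T a b)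
    dCoeff-cone {G} {T} q a b mp hab = begin
      dCoeff (cone G a b q) T               ≈⟨ dCoeff≈∑∑ (cone G a b q) T ⟩
      ∑∑ (dTerm (cone G a b q) T)           ≈⟨ ∑∑-cong term ⟩
      ∑∑ (λ x y → - s * dTerm q T′ x y)     ≈⟨ sum-cong-≋ (λ x → *-distribˡ-sum (- s) (dTerm q T′ x)) ⟨
      ∑ (λ x → - s * sum (dTerm q T′ x))    ≈⟨ *-distribˡ-sum (- s) (λ x → sum (dTerm q T′ x)) ⟨
      - s * ∑∑ (dTerm q T′)                 ≈⟨ *-congˡ (dCoeff≈∑∑ q T′) ⟨
      - s * dCoeff q T′                     ∎
      where
      s = faceSign T a b
      T′ = remove T a b
      ∑ = sum {V}
      at-ab : dTerm (cone G a b q) T a b ≈ - s * dTerm q T′ a b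
      at-ab = begin
        dTerm (cone G a b q) T a b ≡⟨ ≡.cong (λ h → if h then s * cone G a b q T′ else 0#) hab ⟩
        s * cone G a b q T′        ≈⟨ *-congˡ (restrict-vanishes (coneSupport? G a b) (coneValue a b q) {T′} λ (_ , h) → contradiction h (¬HasEdge-remove T a b)) ⟩
        s * 0#                     ≈⟨ zeroʳ s ⟩
        0#                         ≈⟨ zeroʳ (- s) ⟨
        - s * 0#                   ≡⟨ ≡.cong (λ h → - s * (if h then faceSign T′ a b * q (remove T′ a b) else 0#)) (has-remove-self T a b) ⟨
        - s * dTerm q T′ a b       ∎
      off-ab : ∀ x y → (x , y) ≢ (a , b) → dTerm (cone G a b q) T x y ≈ - s * dTerm q T′ x y
      off-ab x y xy≢ab rewrite has-remove-other T a b x y xy≢ab with has T x y in hxy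
      ... | false = sym (zeroʳ (- s))
      ... | true  = begin
        faceSign T x y * cone G a b q (remove T x y)                       ≈⟨ *-congˡ (restrict-≈ (coneSupport? G a b) (coneValue a b q)
                                                                                 (multipath-remove mp x y , ≡.trans (has-remove-other T x y a b (xy≢ab ∘ ≡.sym)) hab)) ⟩
        faceSign T x y * (faceSign (remove T x y) a b * q (remove (remove T x y) a b)) ≈⟨ *-assoc _ _ _ ⟨
        faceSign T x y * faceSign (remove T x y) a b * q (remove (remove T x y) a b) ≈⟨ *-cong (faceSign-swap T x y a b hxy hab xy≢ab)
                                                                                            (reflexive (≡.cong q (remove-comm T x y a b))) ⟩
        - s * faceSign T′ x y * q (remove T′ x y)                          ≈⟨ *-assoc _ _ _ ⟩
        - s * (faceSign T′ x y * q (remove T′ x y))                        ∎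
      term : ∀ x y → dTerm (cone G a b q) T x y ≈ - s * dTerm q T′ x y
      term x y with x ≟ a | y ≟ b
      ... | yes ≡.refl | yes ≡.refl = at-ab
      ... | no x≢a     | _          = off-ab x y (x≢a ∘ proj₁ ∘ ,-injective)
      ... | yes _      | no y≢b     = off-ab x y (y≢b ∘ proj₂ ∘ ,-injective)

    cocycle-exact : ∀ {G : Digraph V} → HVanishes G → ∀ n u → IsCochain G n u → IsCocycle G u →
                    ∃ λ q → IsCochainBelow G n q × (u IsCoboundaryOf q inGraph G)
    cocycle-exact HV zero u u-cochain u-cocycle =
      (λ _ → 0#) , (λ _ _ → refl) ,
      λ X _ → trans (proj₁ HV u u-cochain u-cocycle X) (sym (dCoeff-zero (λ _ → 0#) X λ _ _ _ → refl))
    cocycle-exact HV (suc n) u u-cochain u-cocycle with proj₂ HV n u u-cochain u-cocycle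
    ... | q , q-cochain , u≈dq = q , (λ X ¬X → q-cochain X λ (mp , size≡) → ¬X (mp , ≡.cong suc size≡)) , u≈dq

  -- the last step of the coboundary computation at a multipath through a special edge
  balance : ∀ f r s a b → r + s * b ≈ f + - s * (a - b) → f ≈ s * a + r
  balance f r s a b eq = begin
    f                       ≈⟨ //-rightDividesˡ x f ⟨
    f - x + x               ≈⟨ +-comm (f - x) x ⟩
    x + (f - x)             ≈⟨ +-congˡ (∙-cancelʳ y r (f - x) (begin
      r + y                   ≈⟨ eq ⟩
      f + - s * (a - b)       ≈⟨ +-congˡ (-‿distribˡ-* s (a - b)) ⟨
      f + - (s * (a - b))     ≈⟨ +-congˡ (-‿cong (x[y-z]≈xy-xz s a b)) ⟩
      f + - (x - y)           ≈⟨ +-congˡ (⁻¹-anti-homo‿- x y) ⟩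
      f + (y - x)             ≈⟨ +-congˡ (+-comm y (- x)) ⟩
      f + (- x + y)           ≈⟨ +-assoc f (- x) y ⟨
      f - x + y               ∎)) ⟨
    x + r                   ∎
    where
    x = s * a
    y = s * b
    open import Algebra.Properties.Group +-group using (//-rightDividesˡ; ∙-cancelʳ)
    open import Algebra.Properties.Ring ring using (x[y-z]≈xy-xz; ⁻¹-anti-homo‿-)

-- Splitting off a family of edges that no multipath uses twice

module SpecialEdges {V} (G A : Digraph V) {k} (src tgt : Fin k → Fin V)
  (G-edges : ∀ x y → G x y ≡ true → A x y ≡ true ⊎ ∃ λ h → (src h , tgt h) ≡ (x , y))
  (A⊆G : ∀ x y → A x y ≡ true → G x y ≡ true)
  (special⊆G : ∀ h → G (src h) (tgt h) ≡ true)
  (special∉A : ∀ h → A (src h) (tgt h) ≡ false)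
  (special-injective : ∀ h j → (src h , tgt h) ≡ (src j , tgt j) → h ≡ j)
  (uses-at-most-one : ∀ T → IsMultipath G T → ∀ h j →
                      has T (src h) (tgt h) ≡ true → has T (src j) (tgt j) ≡ true → h ≡ j)
  where

  B : Fin k → Digraph V
  B h = addEdge A (src h) (tgt h)

  uses : Fin k → EdgeSet V → Bool
  uses h T = has T (src h) (tgt h)

  Avoids : EdgeSet V → Set
  Avoids T = ∀ h → uses h T ≡ false

  avoids? : ∀ T → Dec (Avoids T)
  avoids? T = Fin.all? λ h → uses h T Data.Bool.≟ false

  UsesOnly : Fin k → EdgeSet V → Set
  UsesOnly h T = Avoids (remove T (src h) (tgt h))

  usesOnly? : ∀ h T → Dec (UsesOnly h T)
  usesOnly? h T = avoids? (remove T (src h) (tgt h))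

  avoids-or-uses : ∀ T → Avoids T ⊎ ∃ λ h → uses h T ≡ true
  avoids-or-uses T with Fin.any? (λ h → uses h T Data.Bool.≟ true)
  ... | yes used = inj₂ used
  ... | no ¬used = inj₁ λ h → false-unless-true (λ u → ¬used (h , u))
    where
    false-unless-true : ∀ {b} → b ≢ true → b ≡ false
    false-unless-true {false} _  = ≡.refl
    false-unless-true {true}  ¬t = contradiction ≡.refl ¬t

  uses-remove : ∀ {h T} x y → uses h (remove T x y) ≡ true → uses h T ≡ true
  uses-remove {h} {T} x y = has-remove⇒has T x y (src h) (tgt h)

  Avoids-remove : ∀ {T} x y → Avoids T → Avoids (remove T x y)
  Avoids-remove {T} x y av h = ≡.trans (has-remove T x y (src h) (tgt h)) (≡.cong (_∧ _) (av h))

  UsesOnly-remove : ∀ {h T} x y → UsesOnly h T → UsesOnly h (remove T x y)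
  UsesOnly-remove {h} {T} x y only = ≡.subst Avoids (remove-comm T (src h) (tgt h) x y) (Avoids-remove {remove T (src h) (tgt h)} x y only)

  Avoids⇒UsesOnly : ∀ {h T} → Avoids T → UsesOnly h T
  Avoids⇒UsesOnly {h} {T} = Avoids-remove {T} (src h) (tgt h)

  size-zero⇒Avoids : ∀ {T} → size T ≡ 0 → Avoids T
  size-zero⇒Avoids {T} size≡0 h with uses h T in used
  ... | false = ≡.refl
  ... | true  with () ← ≡.trans (≡.sym size≡0) (size-remove T (src h) (tgt h) used)

  uses-other : ∀ {h j} T → j ≢ h → uses j (remove T (src h) (tgt h)) ≡ uses j T
  uses-other {h} {j} T j≢h = has-remove-other T (src h) (tgt h) (src j) (tgt j) (j≢h ∘ special-injective j h)

  B-edges : ∀ {h} x y → B h x y ≡ true → A x y ≡ true ⊎ (x , y) ≡ (src h , tgt h)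
  B-edges {h} x y e with A x y | x ≟ src h | y ≟ tgt h
  ... | true  | _          | _          = inj₁ ≡.refl
  ... | false | yes ≡.refl | yes ≡.refl = inj₂ ≡.refl
  ... | false | yes _      | no _       with () ← e
  ... | false | no _       | _          with () ← e

  A⊆B : ∀ {h} x y → A x y ≡ true → B h x y ≡ true
  A⊆B x y a = ≡.cong (_∨ _) a

  special∈B : ∀ h → B h (src h) (tgt h) ≡ true
  special∈B h = ≡.trans (≡.cong (A (src h) (tgt h) ∨_) (≡.cong₂ _∧_ (⌊⌋-true (src h ≟ src h) ≡.refl) (⌊⌋-true (tgt h ≟ tgt h) ≡.refl)))
                        (∨-zeroʳ _)

  multipathA⇒G : ∀ {T} → IsMultipath A T → IsMultipath G T
  multipathA⇒G mp = multipath-mono mp λ x y h → A⊆G x y (IsMultipath.sub mp x y h)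

  multipathB⇒G : ∀ {h T} → IsMultipath (B h) T → IsMultipath G T
  multipathB⇒G {h} mp = multipath-mono mp λ x y e → B⊆G x y (IsMultipath.sub mp x y e)
    where
    B⊆G : ∀ x y → B h x y ≡ true → G x y ≡ true
    B⊆G x y e with B-edges x y e
    ... | inj₁ a       = A⊆G x y a
    ... | inj₂ ≡.refl  = special⊆G h

  multipathA⇒Avoids : ∀ {T} → IsMultipath A T → Avoids T
  multipathA⇒Avoids {T} mp h with uses h T in used
  ... | false = ≡.refl
  ... | true  with () ← ≡.trans (≡.sym (IsMultipath.sub mp _ _ used)) (special∉A h)

  multipathG⇒A : ∀ {T} → IsMultipath G T → Avoids T → IsMultipath A T
  multipathG⇒A {T} mp av = multipath-mono mp λ x y e → T⊆A x y e (G-edges x y (IsMultipath.sub mp x y e))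
    where
    T⊆A : ∀ x y → has T x y ≡ true → A x y ≡ true ⊎ ∃ (λ h → (src h , tgt h) ≡ (x , y)) → A x y ≡ true
    T⊆A x y _ (inj₁ a)             = a
    T⊆A x y e (inj₂ (h , ≡.refl)) with () ← ≡.trans (≡.sym e) (av h)

  multipathB⇒UsesOnly : ∀ {h T} → IsMultipath (B h) T → UsesOnly h T
  multipathB⇒UsesOnly {h} {T} mp j with j ≟ h
  ... | yes ≡.refl = has-remove-self T (src h) (tgt h)
  ... | no j≢h with uses j T in used
  ...   | false = ≡.trans (uses-other T j≢h) used
  ...   | true  with B-edges (src j) (tgt j) (IsMultipath.sub mp _ _ used)
  ...     | inj₁ a  with () ← ≡.trans (≡.sym a) (special∉A j)
  ...     | inj₂ eq = contradiction (special-injective j h eq) j≢h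

  multipathG⇒B : ∀ {h T} → IsMultipath G T → UsesOnly h T → IsMultipath (B h) T
  multipathG⇒B {h} {T} mp only = multipath-mono mp λ x y e → T⊆B x y e (G-edges x y (IsMultipath.sub mp x y e))
    where
    T⊆B : ∀ x y → has T x y ≡ true → A x y ≡ true ⊎ ∃ (λ j → (src j , tgt j) ≡ (x , y)) → B h x y ≡ true
    T⊆B x y _ (inj₁ a)             = A⊆B x y a
    T⊆B x y e (inj₂ (j , ≡.refl)) with j ≟ h
    ... | yes ≡.refl = special∈B h
    ... | no j≢h     with () ← ≡.trans (≡.sym e) (≡.trans (≡.sym (uses-other T j≢h)) (only j))

  uses⇒UsesOnly : ∀ {h T} → IsMultipath G T → uses h T ≡ true → UsesOnly h T
  uses⇒UsesOnly {h} {T} mp used-h j with j ≟ h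
  ... | yes ≡.refl = has-remove-self T (src h) (tgt h)
  ... | no j≢h with uses j T in used-j
  ...   | false = ≡.trans (uses-other T j≢h) used-j
  ...   | true  = contradiction (uses-at-most-one T mp j h used-j used-h) j≢h

  module Exactness {c ℓ} (K : Field c ℓ) where
    open Field K
    open Cochains K
    open CochainAlgebra K
    open import Algebra.Properties.Semiring.Sum semiring using (sum)
    open FiniteSums +-commutativeMonoid using (sum-zero; sum-single)
    open import Relation.Binary.Reasoning.Setoid setoid

    restrictA-cochain : ∀ {m f} → IsCochain G m f → IsCochain A m (restrict avoids? f)
    restrictA-cochain {f = f} = restrict-cochain avoids? f λ _ → multipathG⇒A

    restrictA-cocycle : ∀ {f} → IsCocycle G f → IsCocycle A (restrict avoids? f)
    restrictA-cocycle {f} = restrict-cocycle avoids? f (λ _ → multipathA⇒G) (λ _ → multipathA⇒Avoids) (λ T → Avoids-remove {T})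

    restrictB-cochain : ∀ {h m f} → IsCochain G m f → IsCochain (B h) m (restrict (usesOnly? h) f)
    restrictB-cochain {h} {f = f} = restrict-cochain (usesOnly? h) f λ _ → multipathG⇒B

    restrictB-cocycle : ∀ {h f} → IsCocycle G f → IsCocycle (B h) (restrict (usesOnly? h) f)
    restrictB-cocycle {h} {f} = restrict-cocycle (usesOnly? h) f (λ _ → multipathB⇒G) (λ _ → multipathB⇒UsesOnly) (λ T → UsesOnly-remove {h} {T})

    module _ (HA : HVanishes A) (HB : ∀ h → HVanishes (B h)) where

      vanishes-degree-0 : ∀ f → IsCochain G 0 f → IsCocycle G f → ∀ T → f T ≈ 0#
      vanishes-degree-0 f f-cochain f-cocycle T with size T ℕ.≟ 0
      ... | no size≢0 = f-cochain T (size≢0 ∘ proj₂)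
      ... | yes size≡0 = begin
        f T                   ≈⟨ restrict-≈ avoids? f (size-zero⇒Avoids {T} size≡0) ⟨
        restrict avoids? f T  ≈⟨ proj₁ HA (restrict avoids? f) (restrictA-cochain f-cochain) (restrictA-cocycle {f} f-cocycle) T ⟩
        0#                    ∎

      module Primitive (n : ℕ) (f : Cochain) (f-cochain : IsCochain G (suc n) f) (f-cocycle : IsCocycle G f) where

        private
          primitiveA = proj₂ HA n (restrict avoids? f) (restrictA-cochain f-cochain) (restrictA-cocycle {f} f-cocycle)

        gA : Cochain
        gA = proj₁ primitiveA

        gA-cochain : IsCochain A n gA
        gA-cochain = proj₁ (proj₂ primitiveA)

        gA-coboundary : restrict avoids? f IsCoboundaryOf gA inGraph A
        gA-coboundary = proj₂ (proj₂ primitiveA)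

        module _ (h : Fin k) where

          private
            primitiveB = proj₂ (HB h) n (restrict (usesOnly? h) f) (restrictB-cochain f-cochain) (restrictB-cocycle {h} {f} f-cocycle)

          gB : Cochain
          gB = proj₁ primitiveB

          gB-cochain : IsCochain (B h) n gB
          gB-cochain = proj₁ (proj₂ primitiveB)

          gB-coboundary : restrict (usesOnly? h) f IsCoboundaryOf gB inGraph B h
          gB-coboundary = proj₂ (proj₂ primitiveB)

          -- gA and gB are both primitives of f on A, so they differ by a cocycle there
          discrepancy : Cochain
          discrepancy X = gA X - restrict avoids? gB X

          discrepancy-cochain : IsCochain A n discrepancy
          discrepancy-cochain = cochain-- gA-cochain
            (restrict-cochain avoids? gB (λ _ mp → multipathG⇒A (multipathB⇒G mp)) gB-cochain)

          discrepancy-cocycle : IsCocycle A discrepancy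
          discrepancy-cocycle T mp = begin
            dCoeff discrepancy T                             ≈⟨ dCoeff-- gA (restrict avoids? gB) T ⟩
            dCoeff gA T - dCoeff (restrict avoids? gB) T     ≈⟨ +-congˡ (-‿cong (dCoeff-restrict avoids? gB T λ x y _ → Avoids-remove {T} x y avoids)) ⟩
            dCoeff gA T - dCoeff gB T                        ≈⟨ +-cong (gA-coboundary T mp) (-‿cong (gB-coboundary T (multipathG⇒B (multipathA⇒G mp) (Avoids⇒UsesOnly {h} {T} avoids)))) ⟨
            restrict avoids? f T - restrict (usesOnly? h) f T ≈⟨ +-cong (restrict-≈ avoids? f avoids) (-‿cong (restrict-≈ (usesOnly? h) f (Avoids⇒UsesOnly {h} {T} avoids))) ⟩
            f T - f T                                        ≈⟨ -‿inverseʳ (f T) ⟩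
            0#                                               ∎
            where avoids = multipathA⇒Avoids mp

          private
            primitiveD = cocycle-exact HA n discrepancy discrepancy-cochain discrepancy-cocycle

          q : Cochain
          q = proj₁ primitiveD

          q-below : IsCochainBelow A n q
          q-below = proj₁ (proj₂ primitiveD)

          q-coboundary : discrepancy IsCoboundaryOf q inGraph A
          q-coboundary = proj₂ (proj₂ primitiveD)

          correction : Cochain
          correction X = gB X + cone G (src h) (tgt h) q X

          onSpecial : Cochain
          onSpecial = restrict (hasEdge? (src h) (tgt h)) correction

        g : Cochain
        g X = gA X + sum λ h → onSpecial h X

        g-cochain : IsCochain G n g
        g-cochain = cochain-+ (cochain-mono (λ _ → multipathA⇒G) gA-cochain) (cochain-sum λ h →
          restrict-cochain (hasEdge? (src h) (tgt h)) (correction h) (λ _ mp _ → mp)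
            (cochain-+ (cochain-mono (λ _ → multipathB⇒G) (gB-cochain h)) (cone-cochain (q-below h))))

        dCoeff-g : ∀ T → dCoeff g T ≈ dCoeff gA T + sum λ h → dCoeff (onSpecial h) T
        dCoeff-g T = trans (dCoeff-+ gA (λ X → sum λ h → onSpecial h X) T) (+-congˡ (dCoeff-sum onSpecial T))

        coboundary-avoiding : ∀ T → IsMultipath G T → Avoids T → f T ≈ dCoeff g T
        coboundary-avoiding T mp avoids = begin
          f T                                              ≈⟨ restrict-≈ avoids? f avoids ⟨
          restrict avoids? f T                             ≈⟨ gA-coboundary T (multipathG⇒A mp avoids) ⟩
          dCoeff gA T                                      ≈⟨ +-identityʳ _ ⟨
          dCoeff gA T + 0#                                 ≈⟨ +-congˡ (sum-zero λ h → dCoeff-zero (onSpecial h) T λ x y _ →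
                                                                restrict-vanishes (hasEdge? (src h) (tgt h)) (correction h) λ used →
                                                                  contradiction (≡.trans (≡.sym used) (Avoids-remove {T} x y avoids h)) λ ()) ⟨
          dCoeff gA T + (sum λ h → dCoeff (onSpecial h) T) ≈⟨ dCoeff-g T ⟨
          dCoeff g T                                       ∎

        coboundary-using : ∀ T h → IsMultipath G T → uses h T ≡ true → f T ≈ dCoeff g T
        coboundary-using T h mp used = begin
          f T                                     ≈⟨ balance (f T) (dCoeff (onSpecial h) T) s (gA T′) (gB h T′) (trans (sym split-correction) coboundary-correction) ⟩
          s * gA T′ + dCoeff (onSpecial h) T      ≈⟨ +-cong dCoeff-gA dCoeff-onSpecial ⟨
          dCoeff gA T + (sum λ j → dCoeff (onSpecial j) T) ≈⟨ dCoeff-g T ⟨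
          dCoeff g T                              ∎
          where
          a = src h
          b = tgt h
          s = faceSign T a b
          T′ = remove T a b
          only : UsesOnly h T
          only = uses⇒UsesOnly mp used
          mpA′ : IsMultipath A T′
          mpA′ = multipathG⇒A (multipath-remove mp a b) only

          dCoeff-gA : dCoeff gA T ≈ s * gA T′
          dCoeff-gA = dCoeff-single gA T a b used λ x y _ xy≢ab → gA-cochain (remove T x y) λ (mpA , _) →
            contradiction (≡.trans (≡.sym (≡.trans (has-remove-other T x y a b (xy≢ab ∘ ≡.sym)) used)) (multipathA⇒Avoids mpA h)) λ ()

          dCoeff-onSpecial : (sum λ j → dCoeff (onSpecial j) T) ≈ dCoeff (onSpecial h) T
          dCoeff-onSpecial = sum-single (λ j → dCoeff (onSpecial j) T) h λ j j≢h →
            dCoeff-zero (onSpecial j) T λ x y _ → restrict-vanishes (hasEdge? (src j) (tgt j)) (correction j) λ used-j →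
              contradiction (uses-at-most-one T mp j h (uses-remove {j} {T} x y used-j) used) j≢h

          split-correction : dCoeff (correction h) T ≈ dCoeff (onSpecial h) T + s * gB h T′
          split-correction = trans (dCoeff-restrict-edge (correction h) T a b used)
            (+-congˡ (*-congˡ (trans (+-congˡ (restrict-vanishes (coneSupport? G a b) (coneValue a b (q h)) {T′} λ (_ , e) →
                                                 contradiction e (¬HasEdge-remove T a b)))
                                      (+-identityʳ _))))

          coboundary-correction : dCoeff (correction h) T ≈ f T + - s * (gA T′ - gB h T′)
          coboundary-correction = begin
            dCoeff (correction h) T                            ≈⟨ dCoeff-+ (gB h) (cone G a b (q h)) T ⟩
            dCoeff (gB h) T + dCoeff (cone G a b (q h)) T      ≈⟨ +-cong (sym (gB-coboundary h T (multipathG⇒B mp only))) (dCoeff-cone (q h) a b mp used) ⟩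
            restrict (usesOnly? h) f T + - s * dCoeff (q h) T′ ≈⟨ +-cong (restrict-≈ (usesOnly? h) f only) (*-congˡ (sym (q-coboundary h T′ mpA′))) ⟩
            f T + - s * discrepancy h T′                       ≈⟨ +-congˡ (*-congˡ (+-congˡ (-‿cong (restrict-≈ avoids? (gB h) only)))) ⟩
            f T + - s * (gA T′ - gB h T′)                      ∎

        g-coboundary : f IsCoboundaryOf g inGraph G
        g-coboundary T mp =
          [ coboundary-avoiding T mp , (λ (h , used) → coboundary-using T h mp used) ]′ (avoids-or-uses T)

      vanishes : HVanishes G
      vanishes = vanishes-degree-0 , λ n f f-cochain f-cocycle →
        let open Primitive n f f-cochain f-cocycle in g , g-cochain , g-coboundary

-- The two instances: the edges into v, and the edges out of v

module _ {c ℓ} (K : Field c ℓ) {V} (G : Digraph V) (v : Fin V) {k} (e : Fin k → Fin V)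
         (e-injective : Injective _≡_ _≡_ e) where
  open Cochains K

  private
    deleted : ∀ x y → G x y ∧ not ⌊ v ≟ v ⌋ ≡ false
    deleted x y = ≡.trans (≡.cong (λ p → G x y ∧ not p) (⌊⌋-true (v ≟ v) ≡.refl)) (∧-zeroʳ _)

  vanishes-splitting-target : (∀ h → G (e h) v ≡ true) → (∀ x → G x v ≡ true → ∃ λ h → e h ≡ x) →
                              (∀ h → HVanishes (addEdge (delIn G v) (e h) v)) → HVanishes (delIn G v) → HVanishes G
  vanishes-splitting-target into into-only HB HA =
    SpecialEdges.Exactness.vanishes G (delIn G v) e (λ _ → v) G-edges (λ _ _ → ∧-conicalˡ _ _) into
      (λ h → deleted (e h) v) (λ _ _ → e-injective ∘ proj₁ ∘ ,-injective)
      (λ _ mp _ _ h j → e-injective (multipath-in-unique mp h j)) K HA HB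
    where
    G-edges : ∀ x y → G x y ≡ true → delIn G v x y ≡ true ⊎ ∃ λ h → (e h , v) ≡ (x , y)
    G-edges x y g with y ≟ v
    ... | yes ≡.refl = let (h , eh≡x) = into-only x g in inj₂ (h , ≡.cong (_, v) eh≡x)
    ... | no _       = inj₁ (≡.trans (∧-identityʳ _) g)

  vanishes-splitting-source : (∀ h → G v (e h) ≡ true) → (∀ y → G v y ≡ true → ∃ λ h → e h ≡ y) →
                              (∀ h → HVanishes (addEdge (delOut G v) v (e h))) → HVanishes (delOut G v) → HVanishes G
  vanishes-splitting-source out-of out-of-only HB HA =
    SpecialEdges.Exactness.vanishes G (delOut G v) (λ _ → v) e G-edges (λ _ _ → ∧-conicalˡ _ _) out-of
      (λ h → deleted v (e h)) (λ _ _ → e-injective ∘ proj₂ ∘ ,-injective)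
      (λ _ mp _ _ h j → e-injective (multipath-out-unique mp h j)) K HA HB
    where
    G-edges : ∀ x y → G x y ≡ true → delOut G v x y ≡ true ⊎ ∃ λ h → (v , e h) ≡ (x , y)
    G-edges x y g with x ≟ v
    ... | yes ≡.refl = let (h , eh≡y) = out-of-only y g in inj₂ (h , ≡.cong (v ,_) eh≡y)
    ... | no _       = inj₁ (≡.trans (∧-identityʳ _) g)

mainTheorem4 : ∀ {c ℓ} (K : Field c ℓ) → let open Cochains K in
    (∀ {V} (G : Digraph V) → Loopless G → (v : Fin V) (k : ℕ) → 2 ≤ k →
    (e : Fin k → Fin V) → Injective _≡_ _≡_ e →
    (∀ h → G (e h) v ≡ true) → (∀ x → G x v ≡ true → ∃ λ h → e h ≡ x) →
    (∀ h → HVanishes (addEdge (delIn G v) (e h) v)) →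
    HVanishes (delIn G v) →
    HVanishes G)
    ×
    (∀ {V} (G : Digraph V) → Loopless G → (v : Fin V) (k : ℕ) → 2 ≤ k →
    (e : Fin k → Fin V) → Injective _≡_ _≡_ e →
    (∀ h → G v (e h) ≡ true) → (∀ y → G v y ≡ true → ∃ λ h → e h ≡ y) →
    (∀ h → HVanishes (addEdge (delOut G v) v (e h))) →
    HVanishes (delOut G v) →
    HVanishes G)
mainTheorem4 K =
  (λ G _ v _ _ e e-injective → vanishes-splitting-target K G v e e-injective) ,
  (λ G _ v _ _ e e-injective → vanishes-splitting-source K G v e e-injective)
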